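{- Fix $L>0$, $0<\alpha<L/2$, $0<\beta<L/2$, and consider the instance consisting of $N$ identical copies of $I_1=[0,L)$ together with one copy of $I_2=[\alpha-L,\alpha)$ and one copy of $I_3=[L-\beta,2L-\beta)$, arriving in a uniformly random order. The never-replace algorithm (which takes a new interval if and only if it conflicts with no interval of its current solution) has competitive ratio $2$ on this instance: with probability tending to $1$ as $N\to\infty$, its final solution contains one interval while $\mathrm{OPT}=2$.
   Context: Unweighted online interval selection: intervals $[s,f)$ arrive one at a time, and the algorithm maintains a set of pairwise non-conflicting (disjoint) intervals; discarded or rejected intervals cannot be taken again. $\mathrm{OPT}$ is the maximum number of pairwise disjoint intervals of the instance, and the competitive ratio is $\mathrm{OPT}/\mathrm{ALG}$, which under random arrival order is required to hold with high probability.
   Formalization: The parameters $L$, $\alpha$, $\beta$ and all interval endpoints are rational. -}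

module Defs where

open import Data.Nat as ℕ using (ℕ)
open import Data.Rational using (ℚ; _≤_; _-_; _+_)
open import Data.Rational.Properties using (_≤?_)
open import Data.List using (List; []; _∷_; _++_; [_]; map; concatMap; replicate; length; filter)
open import Data.List.Relation.Unary.All using (All; all?)
open import Data.List.Relation.Unary.AllPairs using (AllPairs)
open import Data.List.Relation.Binary.Sublist.Propositional using (_⊆_)
open import Data.Sum using (_⊎_)
open import Data.Product using (_×_; ∃)
open import Relation.Nullary using (Dec; yes; no; ¬?)
open import Relation.Nullary.Decidable using (_⊎-dec_)

-- A half-open interval [s , f).
record Interval : Set where
  constructor [_,_⟩
  field
    s f : ℚ
open Interval public

Disjoint : Interval → Interval → Set
Disjoint a b = f a ≤ s b ⊎ f b ≤ s a

disjoint? : (a b : Interval) → Dec (Disjoint a b)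
disjoint? a b = (f a ≤? s b) ⊎-dec (f b ≤? s a)

neverReplaceFrom : List Interval → List Interval → List Interval
neverReplaceFrom S [] = S
neverReplaceFrom S (i ∷ is) with all? (disjoint? i) S
... | yes _ = neverReplaceFrom (S ++ [ i ]) is
... | no  _ = neverReplaceFrom S is

neverReplace : List Interval → List Interval
neverReplace = neverReplaceFrom []

IsOPT : List Interval → ℕ → Set
IsOPT I k =
  (∃ λ J → J ⊆ I × AllPairs Disjoint J × length J ≡ k)
  × (∀ J → J ⊆ I → AllPairs Disjoint J → length J ℕ.≤ k)
  where open import Relation.Binary.PropositionalEquality using (_≡_)

-- All orderings of a list (as a list with multiplicity: each of the n!
-- labelled orderings of the n items appears once).  Uniform random order =
-- uniform choice from this list.
insertions : {A : Set} → A → List A → List (List A)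
insertions x [] = [ [ x ] ]
insertions x (y ∷ ys) = (x ∷ y ∷ ys) ∷ map (y ∷_) (insertions x ys)

orderings : {A : Set} → List A → List (List A)
orderings [] = [ [] ]
orderings (x ∷ xs) = concatMap (insertions x) (orderings xs)

inst : ℚ → ℚ → ℚ → ℕ → List Interval
inst L α β N =
  replicate N [ 0ℚ , L ⟩ ++ [ α - L , α ⟩ ∷ [ L - β , (L + L) - β ⟩ ∷ []
  where open import Data.Rational using (0ℚ)

badOrders : ℚ → ℚ → ℚ → ℕ → ℕ
badOrders L α β N =
  length (filter (λ σ → ¬? (length (neverReplace σ) ℕ.≟ 1)) (orderings (inst L α β N)))

totalOrders : ℚ → ℚ → ℚ → ℕ → ℕ
totalOrders L α β N = length (orderings (inst L α β N))

{-# OPTIONS --safe #-}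
-- Every interval of the instance contains 0 or L - β, so a pairwise disjoint
-- subfamily has at most two members, and I₂, I₃ are two disjoint ones: OPT = 2.
-- I₁ contains both points, hence conflicts with everything.  The never-replace
-- solution therefore has more than one interval exactly when the first arrival
-- has a disjoint partner in the instance, i.e. is I₂ or I₃; in a uniformly
-- random order that happens with probability 2/(N+2).
module Submission where

open import Defs
open import Data.Nat as ℕ using (ℕ; suc; _*_)
open import Data.Rational using (ℚ; 0ℚ; ½; _<_)
open import Data.Rational as Q using ()
open import Data.Product using (_×_; ∃)

open import Data.Empty using (⊥; ⊥-elim)
open import Data.Product using (_,_)
open import Data.Sum using (_⊎_; inj₁; inj₂)
open import Data.List using (List; []; _∷_; _++_; [_]; map; concatMap; replicate; length; filter)
open import Data.List.Properties using (filter-++; filter-all; filter-none; length-++; length-map; length-replicate)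
open import Data.List.Relation.Unary.All as All using (All; []; _∷_; all?)
open import Data.List.Relation.Unary.All.Properties using (map⁺; concat⁺; replicate⁺; ++⁺; ¬Any⇒All¬; All¬⇒¬Any)
open import Data.List.Relation.Unary.Any using (Any; here; there; any?)
open import Data.List.Relation.Unary.Any.Properties using (++⁺ʳ; ¬Any[])
open import Data.List.Relation.Unary.AllPairs using (AllPairs; []; _∷_)
open import Data.List.Relation.Binary.Sublist.Propositional using (_⊆_; []; _∷_; _∷ʳ_)
open import Data.List.Relation.Binary.Sublist.Propositional.Properties using (All-resp-⊆)
open import Data.List.Relation.Binary.Permutation.Propositional using (_↭_; ↭-refl; ↭-prep; ↭-swap; ↭-sym; ↭-trans)
open import Data.List.Relation.Binary.Permutation.Propositional.Properties using (All-resp-↭; Any-resp-↭; ↭-length)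
open import Data.Nat.Properties as ℕ using ()
open import Data.Nat.Tactic.RingSolver using (solve-∀)
open import Data.Rational.Properties using (+-identityˡ; +-monoˡ-<; +-mono-<; +-inverseʳ; <-irrefl; <-≤-trans; ≤-trans; ≤-refl; <⇒≤)
open import Data.Rational.Solver using (module +-*-Solver)
open import Function using (_⇔_; mk⇔; Equivalence)
open import Relation.Nullary using (¬_; yes; no)
open import Relation.Unary using (Decidable)
open import Relation.Binary.PropositionalEquality using (_≡_; refl; sym; trans; cong; cong₂; subst; subst₂; module ≡-Reasoning)

module _ {A : Set} {P : A → Set} (P? : Decidable P) where

  count : List A → ℕ
  count xs = length (filter P? xs)

  count-++ : ∀ xs ys → count (xs ++ ys) ≡ count xs ℕ.+ count ys
  count-++ xs ys = trans (cong length (filter-++ P? xs ys)) (length-++ (filter P? xs))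

module _ {A : Set} where

  count-cong : ∀ {P Q : A → Set} (P? : Decidable P) (Q? : Decidable Q) {xs} →
               All (λ x → P x ⇔ Q x) xs → count P? xs ≡ count Q? xs
  count-cong P? Q? [] = refl
  count-cong P? Q? {x ∷ _} (P⇔Q ∷ rest) with P? x | Q? x
  ... | yes _  | yes _  = cong suc (count-cong P? Q? rest)
  ... | no _   | no _   = count-cong P? Q? rest
  ... | yes px | no ¬qx = ⊥-elim (¬qx (Equivalence.to P⇔Q px))
  ... | no ¬px | yes qx = ⊥-elim (¬px (Equivalence.from P⇔Q qx))

  Head : (A → Set) → List A → Set
  Head P []      = ⊥
  Head P (x ∷ _) = P x

  head? : ∀ {P : A → Set} → Decidable P → Decidable (Head P)
  head? P? []      = no λ ()
  head? P? (x ∷ _) = P? x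

  length-insertions : ∀ (x : A) ys → length (insertions x ys) ≡ suc (length ys)
  length-insertions x []       = refl
  length-insertions x (y ∷ ys) =
    cong suc (trans (length-map (y ∷_) (insertions x ys)) (length-insertions x ys))

  insertions-↭ : ∀ (x : A) ys → All (_↭ x ∷ ys) (insertions x ys)
  insertions-↭ x []       = ↭-refl ∷ []
  insertions-↭ x (y ∷ ys) =
    ↭-refl ∷ map⁺ (All.map (λ τ↭ → ↭-trans (↭-prep y τ↭) (↭-swap y x ↭-refl)) (insertions-↭ x ys))

  orderings-↭ : ∀ (xs : List A) → All (_↭ xs) (orderings xs)
  orderings-↭ []       = ↭-refl ∷ []
  orderings-↭ (x ∷ xs) = concat⁺ (map⁺ (All.map insert (orderings-↭ xs)))
    where
    insert : ∀ {τ} → τ ↭ xs → All (_↭ x ∷ xs) (insertions x τ)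
    insert {τ} τ↭xs = All.map (λ ρ↭ → ↭-trans ρ↭ (↭-prep x τ↭xs)) (insertions-↭ x τ)

  length-concatMap-insertions : ∀ (x : A) {n} ts → All (λ τ → length τ ≡ n) ts →
    length (concatMap (insertions x) ts) ≡ suc n * length ts
  length-concatMap-insertions x {n} []       []             = sym (ℕ.*-zeroʳ (suc n))
  length-concatMap-insertions x {n} (τ ∷ ts) (refl ∷ lengths) = begin
    length (insertions x τ ++ concatMap (insertions x) ts)
      ≡⟨ length-++ (insertions x τ) ⟩
    length (insertions x τ) ℕ.+ length (concatMap (insertions x) ts)
      ≡⟨ cong₂ ℕ._+_ (length-insertions x τ) (length-concatMap-insertions x ts lengths) ⟩
    suc n ℕ.+ suc n * length ts
      ≡⟨ ℕ.*-suc (suc n) (length ts) ⟨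
    suc n * length (τ ∷ ts) ∎
    where open ≡-Reasoning

  module _ {P : A → Set} (P? : Decidable P) where

    count-Head-singleton : ∀ x ρ → count (head? P?) [ x ∷ ρ ] ≡ count P? [ x ]
    count-Head-singleton x ρ with P? x
    ... | yes _ = refl
    ... | no _  = refl

    count-Head-map : ∀ y ts → count (head? P?) (map (y ∷_) ts) ≡ length ts * count P? [ y ]
    count-Head-map y ts with P? y
    ... | yes py = begin
      length (filter (head? P?) (map (y ∷_) ts))
        ≡⟨ cong length (filter-all (head? P?) (map⁺ (All.universal (λ _ → py) ts))) ⟩
      length (map (y ∷_) ts)
        ≡⟨ length-map (y ∷_) ts ⟩
      length ts
        ≡⟨ ℕ.*-identityʳ (length ts) ⟨
      length ts * 1 ∎
      where open ≡-Reasoning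
    ... | no ¬py = trans (cong length (filter-none (head? P?) (map⁺ (All.universal (λ _ → ¬py) ts))))
                         (sym (ℕ.*-zeroʳ (length ts)))

    -- Inserting x into y ∷ ρ puts x first once and leaves y first in the other 1 + |ρ| positions.
    count-Head-insertions : ∀ x τ →
      count (head? P?) (insertions x τ) ≡ count P? [ x ] ℕ.+ length τ * count (head? P?) [ τ ]
    count-Head-insertions x []      = trans (count-Head-singleton x []) (sym (ℕ.+-identityʳ _))
    count-Head-insertions x (y ∷ ρ) = begin
      count (head? P?) ([ x ∷ y ∷ ρ ] ++ map (y ∷_) (insertions x ρ))
        ≡⟨ count-++ (head? P?) [ x ∷ y ∷ ρ ] (map (y ∷_) (insertions x ρ)) ⟩
      count (head? P?) [ x ∷ y ∷ ρ ] ℕ.+ count (head? P?) (map (y ∷_) (insertions x ρ))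
        ≡⟨ cong₂ ℕ._+_ (count-Head-singleton x (y ∷ ρ)) (count-Head-map y (insertions x ρ)) ⟩
      count P? [ x ] ℕ.+ length (insertions x ρ) * count P? [ y ]
        ≡⟨ cong₂ (λ m c → count P? [ x ] ℕ.+ m * c) (length-insertions x ρ) (sym (count-Head-singleton y ρ)) ⟩
      count P? [ x ] ℕ.+ length (y ∷ ρ) * count (head? P?) [ y ∷ ρ ] ∎
      where open ≡-Reasoning

    count-Head-concatMap-insertions : ∀ x {n} ts → All (λ τ → length τ ≡ n) ts →
      count (head? P?) (concatMap (insertions x) ts)
        ≡ length ts * count P? [ x ] ℕ.+ n * count (head? P?) ts
    count-Head-concatMap-insertions x {n} []       []             = sym (ℕ.*-zeroʳ n)
    count-Head-concatMap-insertions x {n} (τ ∷ ts) (refl ∷ lengths) = begin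
      count (head? P?) (insertions x τ ++ concatMap (insertions x) ts)
        ≡⟨ count-++ (head? P?) (insertions x τ) (concatMap (insertions x) ts) ⟩
      count (head? P?) (insertions x τ) ℕ.+ count (head? P?) (concatMap (insertions x) ts)
        ≡⟨ cong₂ ℕ._+_ (count-Head-insertions x τ) (count-Head-concatMap-insertions x ts lengths) ⟩
      (c ℕ.+ n * h) ℕ.+ (length ts * c ℕ.+ n * H)
        ≡⟨ regroup c h (length ts) H n ⟩
      suc (length ts) * c ℕ.+ n * (h ℕ.+ H)
        ≡⟨ cong (λ z → suc (length ts) * c ℕ.+ n * z) (count-++ (head? P?) [ τ ] ts) ⟨
      length (τ ∷ ts) * c ℕ.+ n * count (head? P?) (τ ∷ ts) ∎
      where
      open ≡-Reasoning
      c = count P? [ x ]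
      h = count (head? P?) [ τ ]
      H = count (head? P?) ts
      regroup : ∀ c h T H n → (c ℕ.+ n * h) ℕ.+ (T * c ℕ.+ n * H) ≡ suc T * c ℕ.+ n * (h ℕ.+ H)
      regroup = solve-∀

    -- Each element of xs comes first in the same number (|xs| - 1)! of orderings.
    count-Head-orderings : ∀ xs →
      count (head? P?) (orderings xs) * length xs ≡ count P? xs * length (orderings xs)
    count-Head-orderings []       = refl
    count-Head-orderings (x ∷ xs) = begin
      count (head? P?) (concatMap (insertions x) O) * suc n
        ≡⟨ cong (_* suc n) (count-Head-concatMap-insertions x O lengths) ⟩
      (T * c ℕ.+ n * H) * suc n
        ≡⟨ expand c n T H ⟩
      T * c * suc n ℕ.+ H * n * suc n
        ≡⟨ cong (λ z → T * c * suc n ℕ.+ z * suc n) (count-Head-orderings xs) ⟩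
      T * c * suc n ℕ.+ count P? xs * T * suc n
        ≡⟨ collect c (count P? xs) n T ⟩
      (c ℕ.+ count P? xs) * (suc n * T)
        ≡⟨ cong₂ _*_ (count-++ P? [ x ] xs) (length-concatMap-insertions x O lengths) ⟨
      count P? (x ∷ xs) * length (orderings (x ∷ xs)) ∎
      where
      open ≡-Reasoning
      O = orderings xs
      n = length xs
      T = length O
      c = count P? [ x ]
      H = count (head? P?) O
      lengths : All (λ τ → length τ ≡ n) O
      lengths = All.map ↭-length (orderings-↭ xs)
      expand : ∀ c n T H → (T * c ℕ.+ n * H) * suc n ≡ T * c * suc n ℕ.+ H * n * suc n
      expand = solve-∀
      collect : ∀ c d n T → T * c * suc n ℕ.+ d * T * suc n ≡ (c ℕ.+ d) * (suc n * T)
      collect = solve-∀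

_∈ᵢ_ : ℚ → Interval → Set
p ∈ᵢ a = s a Q.≤ p × p < f a

common-point⇒¬Disjoint : ∀ {p a b} → p ∈ᵢ a → p ∈ᵢ b → ¬ Disjoint a b
common-point⇒¬Disjoint (_ , p<fa) (sb≤p , _) (inj₁ fa≤sb) = <-irrefl refl (<-≤-trans p<fa (≤-trans fa≤sb sb≤p))
common-point⇒¬Disjoint (sa≤p , _) (_ , p<fb) (inj₂ fb≤sa) = <-irrefl refl (<-≤-trans p<fb (≤-trans fb≤sa sa≤p))

PiercedBy : ℚ → ℚ → Interval → Set
PiercedBy p q a = p ∈ᵢ a ⊎ q ∈ᵢ a

pierced-pairwiseDisjoint⇒length≤2 : ∀ {p q} J → All (PiercedBy p q) J → AllPairs Disjoint J → length J ℕ.≤ 2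
pierced-pairwiseDisjoint⇒length≤2 []            _ _ = ℕ.z≤n
pierced-pairwiseDisjoint⇒length≤2 (_ ∷ [])      _ _ = ℕ.s≤s ℕ.z≤n
pierced-pairwiseDisjoint⇒length≤2 (_ ∷ _ ∷ [])  _ _ = ℕ.≤-refl
pierced-pairwiseDisjoint⇒length≤2 (_ ∷ _ ∷ _ ∷ _) (ma ∷ mb ∷ mc ∷ _) ((dab ∷ dac ∷ _) ∷ (dbc ∷ _) ∷ _) =
  ⊥-elim (pigeonhole ma mb mc)
  where
  pigeonhole : _ → _ → _ → ⊥
  pigeonhole (inj₁ pa) (inj₁ pb) _         = common-point⇒¬Disjoint pa pb dab
  pigeonhole (inj₂ qa) (inj₂ qb) _         = common-point⇒¬Disjoint qa qb dab
  pigeonhole (inj₁ pa) (inj₂ _)  (inj₁ pc) = common-point⇒¬Disjoint pa pc dac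
  pigeonhole (inj₁ _)  (inj₂ qb) (inj₂ qc) = common-point⇒¬Disjoint qb qc dbc
  pigeonhole (inj₂ _)  (inj₁ pb) (inj₁ pc) = common-point⇒¬Disjoint pb pc dbc
  pigeonhole (inj₂ qa) (inj₁ _)  (inj₂ qc) = common-point⇒¬Disjoint qa qc dac

neverReplaceFrom-length-mono : ∀ S xs → length S ℕ.≤ length (neverReplaceFrom S xs)
neverReplaceFrom-length-mono S []       = ℕ.≤-refl
neverReplaceFrom-length-mono S (x ∷ xs) with all? (disjoint? x) S
... | yes _ = ℕ.≤-trans (ℕ.≤-trans (ℕ.m≤m+n (length S) 1) (ℕ.≤-reflexive (sym (length-++ S))))
                        (neverReplaceFrom-length-mono (S ++ [ x ]) xs)
... | no _  = neverReplaceFrom-length-mono S xs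

neverReplaceFrom-conflicting : ∀ {a} xs → All (λ x → ¬ Disjoint x a) xs → neverReplaceFrom [ a ] xs ≡ [ a ]
neverReplaceFrom-conflicting []       _ = refl
neverReplaceFrom-conflicting {a} (x ∷ xs) (¬d ∷ ¬ds) with all? (disjoint? x) [ a ]
... | yes (d ∷ []) = ⊥-elim (¬d d)
... | no _         = neverReplaceFrom-conflicting xs ¬ds

neverReplaceFrom-disjoint : ∀ {a} xs → Any (λ x → Disjoint x a) xs → 2 ℕ.≤ length (neverReplaceFrom [ a ] xs)
neverReplaceFrom-disjoint {a} (x ∷ xs) any with all? (disjoint? x) [ a ]
... | yes _ = neverReplaceFrom-length-mono (a ∷ x ∷ []) xs
neverReplaceFrom-disjoint (x ∷ xs) (here d)   | no ¬d = ⊥-elim (¬d (d ∷ []))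
neverReplaceFrom-disjoint (x ∷ xs) (there ds) | no _  = neverReplaceFrom-disjoint xs ds

neverReplace-length≢1⇔ : ∀ a xs → (¬ length (neverReplace (a ∷ xs)) ≡ 1) ⇔ Any (λ x → Disjoint x a) xs
neverReplace-length≢1⇔ a xs = mk⇔ to from
  where
  to : ¬ length (neverReplaceFrom [ a ] xs) ≡ 1 → Any (λ x → Disjoint x a) xs
  to ≢1 with any? (λ x → disjoint? x a) xs
  ... | yes ds = ds
  ... | no ¬ds = ⊥-elim (≢1 (cong length (neverReplaceFrom-conflicting xs (¬Any⇒All¬ xs ¬ds))))
  from : Any (λ x → Disjoint x a) xs → ¬ length (neverReplaceFrom [ a ] xs) ≡ 1
  from ds ≡1 = ℕ.<-irrefl refl (subst (2 ℕ.≤_) ≡1 (neverReplaceFrom-disjoint xs ds))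

<-from-difference : ∀ {a b} c → 0ℚ < c → b Q.- a ≡ c → a < b
<-from-difference {a} {b} c 0<c b-a≡c =
  subst₂ _<_ (+-identityˡ a) (difference-cancel a b) (+-monoˡ-< a (subst (0ℚ <_) (sym b-a≡c) 0<c))
  where
  open +-*-Solver
  difference-cancel : ∀ a b → (b Q.- a) Q.+ a ≡ b
  difference-cancel = solve 2 (λ a b → (b :- a) :+ a := b) refl

0<+ : ∀ {x y} → 0ℚ < x → 0ℚ < y → 0ℚ < x Q.+ y
0<+ {x} {y} 0<x 0<y = subst (_< x Q.+ y) (+-identityˡ 0ℚ) (+-mono-< 0<x 0<y)

0<difference : ∀ {a b} → a < b → 0ℚ < b Q.- a
0<difference {a} {b} a<b = subst (_< b Q.- a) (+-inverseʳ a) (+-monoˡ-< (Q.- a) a<b)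

module Instance (L α β : ℚ) (0<L : 0ℚ < L) (0<α : 0ℚ < α) (α<L/2 : α < ½ Q.* L)
                (0<β : 0ℚ < β) (β<L/2 : β < ½ Q.* L) where
  open +-*-Solver

  I₁ I₂ I₃ : Interval
  I₁ = [ 0ℚ , L ⟩
  I₂ = [ α Q.- L , α ⟩
  I₃ = [ L Q.- β , (L Q.+ L) Q.- β ⟩

  q : ℚ
  q = L Q.- β

  -- Each inequality below is proved by writing its difference as a sum of the
  -- slacks u, v of the hypotheses and of α, β, L.
  u v : ℚ
  u = ½ Q.* L Q.- α
  v = ½ Q.* L Q.- β

  0<u : 0ℚ < u
  0<u = 0<difference α<L/2

  0<v : 0ℚ < v
  0<v = 0<difference β<L/2

  0∈I₁ : 0ℚ ∈ᵢ I₁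
  0∈I₁ = ≤-refl , 0<L

  q∈I₁ : q ∈ᵢ I₁
  q∈I₁ = <⇒≤ (<-from-difference _ (0<+ (0<+ 0<v 0<v) 0<β)
                 (solve 2 (λ L b → (L :- b) :- con 0ℚ := ((con ½ :* L :- b) :+ (con ½ :* L :- b)) :+ b) refl L β))
       , <-from-difference β 0<β (solve 2 (λ L b → L :- (L :- b) := b) refl L β)

  0∈I₂ : 0ℚ ∈ᵢ I₂
  0∈I₂ = <⇒≤ (<-from-difference _ (0<+ (0<+ 0<u 0<u) 0<α)
                 (solve 2 (λ L a → con 0ℚ :- (a :- L) := ((con ½ :* L :- a) :+ (con ½ :* L :- a)) :+ a) refl L α))
       , 0<α

  q∈I₃ : q ∈ᵢ I₃
  q∈I₃ = ≤-refl , <-from-difference L 0<L (solve 2 (λ L b → ((L :+ L) :- b) :- (L :- b) := L) refl L β)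

  α≤q : α Q.≤ q
  α≤q = <⇒≤ (<-from-difference _ (0<+ 0<u 0<v)
                (solve 3 (λ L a b → (L :- b) :- a := (con ½ :* L :- a) :+ (con ½ :* L :- b)) refl L α β))

  pierced : ∀ N → All (PiercedBy 0ℚ q) (inst L α β N)
  pierced N = ++⁺ (replicate⁺ N (inj₁ 0∈I₁)) (inj₁ 0∈I₂ ∷ inj₂ q∈I₃ ∷ [])

  ¬self-disjoint : ∀ {a} → PiercedBy 0ℚ q a → ¬ Disjoint a a
  ¬self-disjoint (inj₁ 0∈a) = common-point⇒¬Disjoint 0∈a 0∈a
  ¬self-disjoint (inj₂ q∈a) = common-point⇒¬Disjoint q∈a q∈a

  I₁-conflicts : ∀ {a} → PiercedBy 0ℚ q a → ¬ Disjoint a I₁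
  I₁-conflicts (inj₁ 0∈a) = common-point⇒¬Disjoint 0∈a 0∈I₁
  I₁-conflicts (inj₂ q∈a) = common-point⇒¬Disjoint q∈a q∈I₁

  [I₂,I₃]⊆inst : ∀ N → (I₂ ∷ I₃ ∷ []) ⊆ inst L α β N
  [I₂,I₃]⊆inst ℕ.zero    = refl ∷ refl ∷ []
  [I₂,I₃]⊆inst (suc N) = I₁ ∷ʳ [I₂,I₃]⊆inst N

  opt : ∀ N → IsOPT (inst L α β N) 2
  opt N = ((I₂ ∷ I₃ ∷ []) , [I₂,I₃]⊆inst N , (inj₁ α≤q ∷ []) ∷ [] ∷ [] , refl)
        , λ J J⊆inst → pierced-pairwiseDisjoint⇒length≤2 J (All-resp-⊆ J⊆inst (pierced N))

  HasPartner : ℕ → Interval → Set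
  HasPartner N a = Any (λ x → Disjoint x a) (inst L α β N)

  hasPartner? : ∀ N → Decidable (HasPartner N)
  hasPartner? N a = any? (λ x → disjoint? x a) (inst L α β N)

  I₂-hasPartner : ∀ N → HasPartner N I₂
  I₂-hasPartner N = ++⁺ʳ (replicate N I₁) (there (here (inj₂ α≤q)))

  I₃-hasPartner : ∀ N → HasPartner N I₃
  I₃-hasPartner N = ++⁺ʳ (replicate N I₁) (here (inj₁ α≤q))

  count-hasPartner : ∀ N → count (hasPartner? N) (inst L α β N) ≡ 2
  count-hasPartner N = begin
    count (hasPartner? N) (replicate N I₁ ++ I₂ ∷ I₃ ∷ [])
      ≡⟨ count-++ (hasPartner? N) (replicate N I₁) (I₂ ∷ I₃ ∷ []) ⟩
    length (filter (hasPartner? N) (replicate N I₁)) ℕ.+ length (filter (hasPartner? N) (I₂ ∷ I₃ ∷ []))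
      ≡⟨ cong (ℕ._+ length (filter (hasPartner? N) (I₂ ∷ I₃ ∷ []))) (cong length (filter-none (hasPartner? N) I₁-lonely)) ⟩
    length (filter (hasPartner? N) (I₂ ∷ I₃ ∷ []))
      ≡⟨ cong length (filter-all (hasPartner? N) (I₂-hasPartner N ∷ I₃-hasPartner N ∷ [])) ⟩
    2 ∎
    where
    open ≡-Reasoning
    I₁-lonely : All (λ a → ¬ HasPartner N a) (replicate N I₁)
    I₁-lonely = replicate⁺ N (All¬⇒¬Any (All.map I₁-conflicts (pierced N)))

  bad⇔Head-hasPartner : ∀ N σ → σ ↭ inst L α β N →
    (¬ length (neverReplace σ) ≡ 1) ⇔ Head (HasPartner N) σ
  bad⇔Head-hasPartner N [] []↭ = ⊥-elim (¬Any[] (Any-resp-↭ (↭-sym []↭) (I₂-hasPartner N)))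
  bad⇔Head-hasPartner N (a ∷ xs) σ↭ = mk⇔
    (λ bad → Any-resp-↭ σ↭ (there (Equivalence.to (neverReplace-length≢1⇔ a xs) bad)))
    (λ partner → Equivalence.from (neverReplace-length≢1⇔ a xs) (later (Any-resp-↭ (↭-sym σ↭) partner)))
    where
    later : Any (λ x → Disjoint x a) (a ∷ xs) → Any (λ x → Disjoint x a) xs
    later (here d)   = ⊥-elim (¬self-disjoint (All.head (All-resp-↭ (↭-sym σ↭) (pierced N))) d)
    later (there ds) = ds

  length-inst : ∀ N → length (inst L α β N) ≡ suc (suc N)
  length-inst N = trans (length-++ (replicate N I₁)) (trans (cong (ℕ._+ 2) (length-replicate N)) (ℕ.+-comm N 2))

  badOrders-ratio : ∀ N → badOrders L α β N * suc (suc N) ≡ 2 * totalOrders L α β N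
  badOrders-ratio N = begin
    badOrders L α β N * suc (suc N)
      ≡⟨ cong₂ _*_ (count-cong _ (head? (hasPartner? N)) (All.map (bad⇔Head-hasPartner N _) (orderings-↭ I)))
                   (sym (length-inst N)) ⟩
    count (head? (hasPartner? N)) (orderings I) * length I
      ≡⟨ count-Head-orderings (hasPartner? N) I ⟩
    count (hasPartner? N) I * length (orderings I)
      ≡⟨ cong (_* totalOrders L α β N) (count-hasPartner N) ⟩
    2 * totalOrders L α β N ∎
    where
    open ≡-Reasoning
    I = inst L α β N

  few-badOrders : ∀ k N → k ℕ.+ k ℕ.≤ N → suc k * badOrders L α β N ℕ.≤ totalOrders L α β N
  few-badOrders k N 2k≤N = ℕ.*-cancelˡ-≤ 2 (begin
    2 * (suc k * B)   ≡⟨ ℕ.*-assoc 2 (suc k) B ⟨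
    2 * suc k * B     ≤⟨ ℕ.*-monoˡ-≤ B 2k+2≤N+2 ⟩
    suc (suc N) * B   ≡⟨ ℕ.*-comm (suc (suc N)) B ⟩
    B * suc (suc N)   ≡⟨ badOrders-ratio N ⟩
    2 * totalOrders L α β N ∎)
    where
    open ℕ.≤-Reasoning
    B = badOrders L α β N
    2k+2≤N+2 : 2 * suc k ℕ.≤ suc (suc N)
    2k+2≤N+2 = subst (ℕ._≤ suc (suc N)) (double-suc k) (ℕ.s≤s (ℕ.s≤s 2k≤N))
      where
      double-suc : ∀ k → suc (suc (k ℕ.+ k)) ≡ 2 * suc k
      double-suc = solve-∀

lemma4 : (L α β : ℚ) → 0ℚ < L → 0ℚ < α → α < ½ Q.* L → 0ℚ < β → β < ½ Q.* L →
    (∀ (N : ℕ) → IsOPT (inst L α β N) 2)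
    × (∀ (k : ℕ) → ∃ λ (N₀ : ℕ) → ∀ (N : ℕ) → N₀ ℕ.≤ N →
         suc k * badOrders L α β N ℕ.≤ totalOrders L α β N)
lemma4 L α β 0<L 0<α α<L/2 0<β β<L/2 = opt , λ k → k ℕ.+ k , few-badOrders k
  where open Instance L α β 0<L 0<α α<L/2 0<β β<L/2
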